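{- For every positive integer $n$, the set of permutations $\sigma\in S_n$ having no preimage under $\mathrm{psb}$ (i.e. $|\mathrm{psb}^{ -1}(\sigma)|=0$) is $\{\sigma=\sigma_1\cdots\sigma_n\in S_n : \sigma_n\neq n\}$, and its cardinality is $(n-1)\,(n-1)!$.
   Context: The algorithm PSB processes a permutation $\pi=\pi_1\cdots\pi_n$ from left to right with one pop stack $S$ (initially empty; PUSH puts an element on top, POP removes all elements appending them to the output from top to bottom) and an initially empty output: for $i=1,\dots,n$, if $S$ is empty or $\pi_i=\mathrm{TOP}(S)-1$ (where $\mathrm{TOP}(S)$ is the top element of $S$), push $\pi_i$; else if $\pi_i<\mathrm{TOP}(S)-1$, append $\pi_i$ directly to the output (bypass); otherwise pop $S$ and then push $\pi_i$. After all entries are processed, pop $S$. The output $\mathrm{psb}(\pi)$ is again a permutation of size $n$, so PSB defines a map $\mathrm{psb}:S_n\to S_n$, and $\mathrm{psb}^{ -1}(\sigma)=\{\pi\in S_n:\mathrm{psb}(\pi)=\sigma\}$. -}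

module Defs where

open import Data.Nat using (ℕ; zero; suc; _+_; _<ᵇ_; _≡ᵇ_)
open import Data.Bool using (Bool; true; false; if_then_else_)
open import Data.List using (List; []; _∷_; _++_; applyUpTo)
open import Data.List.Relation.Binary.Permutation.Propositional using (_↭_)

IsPerm : ℕ → List ℕ → Set
IsPerm n l = l ↭ applyUpTo suc n

-- PSB: first argument = remaining input, second = stack (top at the
-- head; POP appends the stack contents top to bottom, i.e. the list
-- itself), third = output so far (in order).
psbStep : List ℕ → List ℕ → List ℕ → List ℕ
psbStep []       stack out = out ++ stack
psbStep (x ∷ xs) []       out = psbStep xs (x ∷ []) out
psbStep (x ∷ xs) (t ∷ st) out =
  if (suc x ≡ᵇ t) then psbStep xs (x ∷ t ∷ st) out
  else if (suc x <ᵇ t) then psbStep xs (t ∷ st) (out ++ x ∷ [])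
  else psbStep xs (x ∷ []) (out ++ t ∷ st)

psb : List ℕ → List ℕ
psb π = psbStep π [] []

module Submission where

-- When n is read, the stack holds only smaller entries, so n ends up alone on the stack. Every
-- later entry is distinct and smaller than the current top, hence pushed (if one less) or
-- bypassed: n stays at the bottom of the stack and is output last. Conversely, write
-- σ = t₁ B₁ t₂ B₂ ⋯ B₍ₖ₋₁₎ tₖ with left-to-right maxima t₁ < ⋯ < tₖ = n and runs Bᵢ of smaller
-- entries. On t₁ t₂ B₁ t₃ B₂ ⋯ tₖ B₍ₖ₋₁₎, PSB pops tᵢ on reading tᵢ₊₁ and then bypasses Bᵢ, so it
-- outputs σ. The permutations not ending in n are listed by their last entry y < n followed by
-- an arbitrary arrangement of the other n - 1 entries.

open import Defs
open import Data.Bool using (true; false)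
open import Data.Empty using (⊥; ⊥-elim)
open import Data.Maybe using (just)
open import Data.Maybe.Properties using (just-injective)
open import Data.Nat using (ℕ; zero; suc; _+_; _*_; _!; _≡ᵇ_; _<ᵇ_; _<_; _≤_; _≟_; _<?_; s≤s)
open import Data.Nat.Properties
  using ( suc-injective; ≤∧≢⇒<; <⇒≤; <⇒≢; ≤-<-trans; <-irrefl; <-asym
        ; ≤⇒≯; ≮⇒≥; m≤n⇒m<n∨m≡n; ≤-refl)
open import Data.Product using (Σ; ∃₂; ∃-syntax; _×_; _,_; proj₁; map₂)
open import Data.Sum using (inj₁; inj₂)
open import Data.List
  using (List; []; _∷_; _++_; [_]; _∷ʳ_; map; concatMap; length; head; last; applyUpTo; initLast; _∷ʳ′_)
open import Data.List.Properties
  using ( length-++; length-map; length-applyUpTo; map-∘; ++-assoc; ++-identityʳ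
        ; ∷-injectiveʳ; ∷ʳ-injectiveˡ; applyUpTo-∷ʳ)
open import Data.List.Relation.Unary.Any using (here; there)
open import Data.List.Relation.Unary.All using (All; []; _∷_)
import Data.List.Relation.Unary.All as All
open import Data.List.Relation.Unary.All.Properties using (∷ʳ⁺; ++⁻ˡ; ++⁻ʳ; All¬⇒¬Any; ¬Any⇒All¬; applyUpTo⁺₁)
open import Data.List.Relation.Unary.AllPairs using ([]; _∷_)
import Data.List.Relation.Unary.AllPairs as AllPairs
open import Data.List.Relation.Unary.Unique.Propositional using (Unique)
import Data.List.Relation.Unary.Unique.Propositional.Properties as Unique
open import Data.List.Membership.Propositional using (_∈_; _∉_; find; lose)
open import Data.List.Membership.Propositional.Properties
  using (∈-concatMap⁺; ∈-concatMap⁻; ∈-map⁺; ∈-map⁻; ∈-++⁺ʳ; ∈-∃++; ∈-applyUpTo⁺)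
open import Data.List.Relation.Binary.Permutation.Propositional
  using (_↭_; prep; swap; ↭-refl; ↭-sym; ↭-trans; ↭-reflexive; ↭⇒↭ₛ)
open import Data.List.Relation.Binary.Permutation.Propositional.Properties
  using (∈-resp-↭; All-resp-↭; ↭-length; ↭-empty-inv; drop-∷; ∷↭∷ʳ; shift; ++⁺ˡ)
import Data.List.Relation.Binary.Permutation.Setoid.Properties as Setoid↭
open import Function using (_∘′_)
open import Function.Bundles using (_⇔_; mk⇔; module Equivalence)
open import Relation.Nullary using (¬_; yes; no)
open import Relation.Nullary.Decidable using (dec-true; dec-false)
open import Relation.Binary.PropositionalEquality
  using (_≡_; _≢_; refl; sym; trans; cong; cong₂; subst; setoid; ≢-sym; module ≡-Reasoning)

module _ {a} {A : Set a} where

  Unique-resp-↭ : {xs ys : List A} → xs ↭ ys → Unique xs → Unique ys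
  Unique-resp-↭ p = Setoid↭.Unique-resp-↭ (setoid A) (↭⇒↭ₛ p)

  Unique-++⁻ʳ : ∀ xs {ys : List A} → Unique (xs ++ ys) → Unique ys
  Unique-++⁻ʳ []       ys!          = ys!
  Unique-++⁻ʳ (x ∷ xs) (_ ∷ xs++ys!) = Unique-++⁻ʳ xs xs++ys!

module _ {a b} {A : Set a} {B : Set b} (f : A → List B) where

  ∈-concatMap⁺′ : ∀ {x xs z} → x ∈ xs → z ∈ f x → z ∈ concatMap f xs
  ∈-concatMap⁺′ x∈ z∈ = ∈-concatMap⁺ f (lose x∈ z∈)

  ∈-concatMap⁻′ : ∀ xs {z} → z ∈ concatMap f xs → ∃[ x ] x ∈ xs × z ∈ f x
  ∈-concatMap⁻′ xs z∈ = find (∈-concatMap⁻ f {xs} z∈)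

  length-concatMap-const : ∀ xs k → (∀ {x} → x ∈ xs → length (f x) ≡ k) →
    length (concatMap f xs) ≡ length xs * k
  length-concatMap-const []       k _   = refl
  length-concatMap-const (x ∷ xs) k len = trans (length-++ (f x))
    (cong₂ _+_ (len (here refl)) (length-concatMap-const xs k (len ∘′ there)))

  concatMap-unique : ∀ {c} {C : Set c} (key : B → C) (h : A → C) → ∀ {xs} →
    (∀ {x z} → x ∈ xs → z ∈ f x → key z ≡ h x) →
    (∀ {x} → x ∈ xs → Unique (f x)) →
    Unique (map h xs) → Unique (concatMap f xs)
  concatMap-unique key h {[]}     _    _    _          = []
  concatMap-unique key h {x ∷ xs} keys uniq (hx∉ ∷ hxs!) =
    Unique.++⁺ (uniq (here refl))
      (concatMap-unique key h (keys ∘′ there) (uniq ∘′ there) hxs!) disjoint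
    where
    disjoint : ∀ {z} → z ∈ f x × z ∈ concatMap f xs → ⊥
    disjoint (z∈fx , z∈rest) with x′ , x′∈ , z∈fx′ ← ∈-concatMap⁻′ xs z∈rest =
      All.lookup hx∉ (∈-map⁺ h x′∈) (trans (sym (keys (here refl) z∈fx)) (keys (there x′∈) z∈fx′))

module _ {a} {A : Set a} where

  select : List A → List (A × List A)
  select []       = []
  select (x ∷ xs) = (x , xs) ∷ map (map₂ (x ∷_)) (select xs)

  select-↭ : ∀ xs {y r} → (y , r) ∈ select xs → xs ↭ y ∷ r
  select-↭ (x ∷ xs) (here refl) = ↭-refl
  select-↭ (x ∷ xs) (there yr∈)
    with (y , r) , yr∈′ , refl ← ∈-map⁻ (map₂ (x ∷_)) yr∈ =
    ↭-trans (prep x (select-↭ xs yr∈′)) (swap x y ↭-refl)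

  ∈-select : ∀ {xs y} → y ∈ xs → ∃[ r ] (y , r) ∈ select xs
  ∈-select {x ∷ xs} (here refl) = xs , here refl
  ∈-select {x ∷ xs} (there y∈) with r , yr∈ ← ∈-select y∈ =
    x ∷ r , there (∈-map⁺ (map₂ (x ∷_)) yr∈)

  map-proj₁-select : ∀ xs → map proj₁ (select xs) ≡ xs
  map-proj₁-select []       = refl
  map-proj₁-select (x ∷ xs) =
    cong (x ∷_) (trans (sym (map-∘ (select xs))) (map-proj₁-select xs))

  length-select : ∀ xs → length (select xs) ≡ length xs
  length-select xs = trans (sym (length-map proj₁ (select xs))) (cong length (map-proj₁-select xs))

  length-select-rest : ∀ xs {y r} → (y , r) ∈ select xs → suc (length r) ≡ length xs
  length-select-rest xs yr∈ = sym (↭-length (select-↭ xs yr∈))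

  -- The index k, equal to the length of the list, makes the recursion structural.
  permutationsOfLength : ℕ → List A → List (List A)
  startingWith : ℕ → A × List A → List (List A)

  permutationsOfLength zero    xs = [ [] ]
  permutationsOfLength (suc k) xs = concatMap (startingWith k) (select xs)

  startingWith k (y , r) = map (y ∷_) (permutationsOfLength k r)

  permutations : List A → List (List A)
  permutations xs = permutationsOfLength (length xs) xs

  private
    length-rest : ∀ {k} xs {y r} → length xs ≡ suc k → (y , r) ∈ select xs → length r ≡ k
    length-rest xs len yr∈ = suc-injective (trans (length-select-rest xs yr∈) len)

    ∈-ofLength⁺ : ∀ k {xs σ} → length xs ≡ k → σ ↭ xs → σ ∈ permutationsOfLength k xs
    ∈-ofLength⁺ zero {[]} _ σ↭ rewrite ↭-empty-inv σ↭ = here refl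
    ∈-ofLength⁺ (suc k) {xs} {[]} len σ↭ with () ← trans (↭-length σ↭) len
    ∈-ofLength⁺ (suc k) {xs} {y ∷ σ} len σ↭
      with r , yr∈ ← ∈-select (∈-resp-↭ σ↭ (here refl)) =
      ∈-concatMap⁺′ (startingWith k) yr∈
        (∈-map⁺ (y ∷_) (∈-ofLength⁺ k (length-rest xs len yr∈) (drop-∷ (↭-trans σ↭ (select-↭ xs yr∈)))))

    ∈-ofLength⁻ : ∀ k {xs σ} → length xs ≡ k → σ ∈ permutationsOfLength k xs → σ ↭ xs
    ∈-ofLength⁻ zero {[]} _ (here refl) = ↭-refl
    ∈-ofLength⁻ (suc k) {xs} len σ∈
      with (y , r) , yr∈ , σ∈′ ← ∈-concatMap⁻′ (startingWith k) (select xs) σ∈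
      with τ , τ∈ , refl ← ∈-map⁻ (y ∷_) σ∈′ =
      ↭-trans (prep y (∈-ofLength⁻ k (length-rest xs len yr∈) τ∈)) (↭-sym (select-↭ xs yr∈))

    length-ofLength : ∀ k {xs} → length xs ≡ k → length (permutationsOfLength k xs) ≡ k !
    length-ofLength zero    _   = refl
    length-ofLength (suc k) {xs} len = begin
      length (concatMap (startingWith k) (select xs))
        ≡⟨ length-concatMap-const (startingWith k) (select xs) (k !) length-block ⟩
      length (select xs) * k !
        ≡⟨ cong (_* k !) (trans (length-select xs) len) ⟩
      suc k * k ! ∎
      where
      open ≡-Reasoning
      length-block : ∀ {yr} → yr ∈ select xs → length (startingWith k yr) ≡ k !
      length-block {y , r} yr∈ =
        trans (length-map _ (permutationsOfLength k r)) (length-ofLength k (length-rest xs len yr∈))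

  unique-selected-heads : ∀ {xs} → Unique xs → Unique (map (just ∘′ proj₁) (select xs))
  unique-selected-heads {xs} xs! = subst Unique (sym (map-∘ {g = just} {f = proj₁} (select xs)))
    (Unique.map⁺ just-injective (subst Unique (sym (map-proj₁-select xs)) xs!))

  private
    ofLength-unique : ∀ k {xs} → Unique xs → Unique (permutationsOfLength k xs)
    ofLength-unique zero    _   = [] ∷ []
    ofLength-unique (suc k) {xs} xs! =
      concatMap-unique (startingWith k) head (just ∘′ proj₁) head-block block-unique
        (unique-selected-heads xs!)
      where
      head-block : ∀ {yr z} → yr ∈ select xs → z ∈ startingWith k yr → head z ≡ just (proj₁ yr)
      head-block {y , r} _ z∈ with τ , _ , refl ← ∈-map⁻ (y ∷_) z∈ = refl
      block-unique : ∀ {yr} → yr ∈ select xs → Unique (startingWith k yr)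
      block-unique {y , r} yr∈ =
        Unique.map⁺ ∷-injectiveʳ (ofLength-unique k (AllPairs.tail (Unique-resp-↭ (select-↭ xs yr∈) xs!)))

  ∈-permutations⁺ : ∀ {xs σ} → σ ↭ xs → σ ∈ permutations xs
  ∈-permutations⁺ {xs} = ∈-ofLength⁺ (length xs) refl

  ∈-permutations⁻ : ∀ {xs σ} → σ ∈ permutations xs → σ ↭ xs
  ∈-permutations⁻ {xs} = ∈-ofLength⁻ (length xs) refl

  permutations-unique : ∀ {xs} → Unique xs → Unique (permutations xs)
  permutations-unique {xs} = ofLength-unique (length xs)

  length-permutations : ∀ xs → length (permutations xs) ≡ length xs !
  length-permutations xs = length-ofLength (length xs) refl

module _ {a} {A : Set a} where

  last-++-∷ : ∀ (xs : List A) y ys → last (xs ++ y ∷ ys) ≡ last (y ∷ ys)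
  last-++-∷ []           y ys = refl
  last-++-∷ (x ∷ [])     y ys = refl
  last-++-∷ (x ∷ x′ ∷ xs) y ys = last-++-∷ (x′ ∷ xs) y ys

  last-∷ʳ : ∀ (xs : List A) y → last (xs ∷ʳ y) ≡ just y
  last-∷ʳ xs y = last-++-∷ xs y []

  permutationsNotEndingIn : A → List A → List (List A)
  endingWith : A → A × List A → List (List A)

  permutationsNotEndingIn x xs = concatMap (endingWith x) (select xs)
  endingWith x (y , r) = map (_∷ʳ y) (permutations (x ∷ r))

  ∈-permutationsNotEndingIn⁺ : ∀ {x xs σ} → σ ↭ x ∷ xs → last σ ≢ just x →
    σ ∈ permutationsNotEndingIn x xs
  ∈-permutationsNotEndingIn⁺ {x} {xs} {σ} σ↭ σ≢ with initLast σ
  ... | [] with () ← ↭-length σ↭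
  ... | τ ∷ʳ′ y with ∈-resp-↭ σ↭ (∈-++⁺ʳ τ (here refl))
  ...   | here refl = ⊥-elim (σ≢ (last-∷ʳ τ y))
  ...   | there y∈ with r , yr∈ ← ∈-select y∈ =
    ∈-concatMap⁺′ (endingWith x) yr∈ (∈-map⁺ (_∷ʳ y) (∈-permutations⁺ τ↭))
    where
    τ↭ : τ ↭ x ∷ r
    τ↭ = drop-∷ (↭-trans (∷↭∷ʳ y τ)
           (↭-trans σ↭ (↭-trans (prep x (select-↭ xs yr∈)) (swap x y ↭-refl))))

  ∈-permutationsNotEndingIn⁻ : ∀ {x xs σ} → x ∉ xs → σ ∈ permutationsNotEndingIn x xs →
    σ ↭ x ∷ xs × last σ ≢ just x
  ∈-permutationsNotEndingIn⁻ {x} {xs} x∉ σ∈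
    with (y , r) , yr∈ , σ∈′ ← ∈-concatMap⁻′ (endingWith x) (select xs) σ∈
    with τ , τ∈ , refl ← ∈-map⁻ (_∷ʳ y) σ∈′ = σ↭ , σ≢
    where
    xs↭ : xs ↭ y ∷ r
    xs↭ = select-↭ xs yr∈
    σ↭ : τ ∷ʳ y ↭ x ∷ xs
    σ↭ = ↭-trans (↭-sym (∷↭∷ʳ y τ)) (↭-trans (prep y (∈-permutations⁻ τ∈))
           (↭-trans (swap y x ↭-refl) (prep x (↭-sym xs↭))))
    σ≢ : last (τ ∷ʳ y) ≢ just x
    σ≢ eq with refl ← just-injective (trans (sym (last-∷ʳ τ y)) eq) =
      x∉ (∈-resp-↭ (↭-sym xs↭) (here refl))

  permutationsNotEndingIn-unique : ∀ {x xs} → Unique (x ∷ xs) → Unique (permutationsNotEndingIn x xs)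
  permutationsNotEndingIn-unique {x} {xs} x∷xs! =
    concatMap-unique (endingWith x) last (just ∘′ proj₁) last-block block-unique
      (unique-selected-heads (AllPairs.tail x∷xs!))
    where
    last-block : ∀ {yr z} → yr ∈ select xs → z ∈ endingWith x yr → last z ≡ just (proj₁ yr)
    last-block {y , r} _ z∈ with τ , _ , refl ← ∈-map⁻ (_∷ʳ y) z∈ = last-∷ʳ τ y
    block-unique : ∀ {yr} → yr ∈ select xs → Unique (endingWith x yr)
    block-unique {y , r} yr∈
      = Unique.map⁺ (∷ʳ-injectiveˡ _ _) (permutations-unique (AllPairs.tail
          (Unique-resp-↭ (↭-trans (prep x (select-↭ xs yr∈)) (swap x y ↭-refl)) x∷xs!)))

  length-permutationsNotEndingIn : ∀ x xs →
    length (permutationsNotEndingIn x xs) ≡ length xs * length xs !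
  length-permutationsNotEndingIn x xs = begin
    length (concatMap (endingWith x) (select xs))
      ≡⟨ length-concatMap-const (endingWith x) (select xs) (length xs !) length-block ⟩
    length (select xs) * length xs !
      ≡⟨ cong (_* length xs !) (length-select xs) ⟩
    length xs * length xs ! ∎
    where
    open ≡-Reasoning
    length-block : ∀ {yr} → yr ∈ select xs → length (endingWith x yr) ≡ length xs !
    length-block {y , r} yr∈ = begin
      length (map (_∷ʳ y) (permutations (x ∷ r))) ≡⟨ length-map (_∷ʳ y) (permutations (x ∷ r)) ⟩
      length (permutations (x ∷ r))               ≡⟨ length-permutations (x ∷ r) ⟩
      suc (length r) !                            ≡⟨ cong _! (length-select-rest xs yr∈) ⟩
      length xs ! ∎

private
  ≡ᵇ-true : ∀ {m n} → m ≡ n → (m ≡ᵇ n) ≡ true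
  ≡ᵇ-true {m} {n} = dec-true (m ≟ n)

  ≡ᵇ-false : ∀ {m n} → m ≢ n → (m ≡ᵇ n) ≡ false
  ≡ᵇ-false {m} {n} = dec-false (m ≟ n)

  <ᵇ-true : ∀ {m n} → m < n → (m <ᵇ n) ≡ true
  <ᵇ-true {m} {n} = dec-true (m <? n)

  <ᵇ-false : ∀ {m n} → n ≤ m → (m <ᵇ n) ≡ false
  <ᵇ-false {m} {n} n≤m = dec-false (m <? n) (≤⇒≯ n≤m)

psbStep-push : ∀ x xs st out → psbStep (x ∷ xs) (suc x ∷ st) out ≡ psbStep xs (x ∷ suc x ∷ st) out
psbStep-push x xs st out rewrite ≡ᵇ-true {suc x} refl = refl

psbStep-bypass : ∀ {x t} xs st out → suc x < t →
  psbStep (x ∷ xs) (t ∷ st) out ≡ psbStep xs (t ∷ st) (out ∷ʳ x)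
psbStep-bypass xs st out x+1<t rewrite ≡ᵇ-false (<⇒≢ x+1<t) | <ᵇ-true x+1<t = refl

psbStep-pop : ∀ {x t} xs st out → t ≤ x →
  psbStep (x ∷ xs) (t ∷ st) out ≡ psbStep xs [ x ] (out ++ t ∷ st)
psbStep-pop xs st out t≤x
  rewrite ≡ᵇ-false (≢-sym (<⇒≢ (s≤s t≤x))) | <ᵇ-false (<⇒≤ (s≤s t≤x)) = refl

psbStep-bypass-all : ∀ {t} block xs st out → All (λ b → suc b < t) block →
  psbStep (block ++ xs) (t ∷ st) out ≡ psbStep xs (t ∷ st) (out ++ block)
psbStep-bypass-all [] xs st out [] = cong (psbStep xs _) (sym (++-identityʳ out))
psbStep-bypass-all {t} (b ∷ block) xs st out (b<t ∷ block<t) = begin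
  psbStep (b ∷ block ++ xs) (t ∷ st) out          ≡⟨ psbStep-bypass (block ++ xs) st out b<t ⟩
  psbStep (block ++ xs) (t ∷ st) (out ∷ʳ b)       ≡⟨ psbStep-bypass-all block xs st (out ∷ʳ b) block<t ⟩
  psbStep xs (t ∷ st) ((out ∷ʳ b) ++ block)       ≡⟨ cong (psbStep xs _) (++-assoc out [ b ] block) ⟩
  psbStep xs (t ∷ st) (out ++ b ∷ block)          ∎
  where open ≡-Reasoning

psbStep-preserves-All-stack : ∀ (P : ℕ → Set) {x xs st} out → P x → All P st →
  ∃₂ λ st′ out′ → All P st′ × psbStep (x ∷ xs) st out ≡ psbStep xs st′ out′
psbStep-preserves-All-stack P out px [] = _ , _ , px ∷ [] , refl
psbStep-preserves-All-stack P {x} {xs} {t ∷ st} out px pst with suc x ≡ᵇ t | suc x <ᵇ t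
... | true  | _     = _ , _ , px ∷ pst , refl
... | false | true  = _ , _ , pst , refl
... | false | false = _ , _ , px ∷ [] , refl

last-psbStep-below-top : ∀ xs {t} st out → Unique xs → All (_< t) xs →
  last (psbStep xs (t ∷ st) out) ≡ last (t ∷ st)
last-psbStep-below-top [] {t} st out _ _ = last-++-∷ out t st
last-psbStep-below-top (x ∷ xs) st out (x∉xs ∷ xs!) (x<t ∷ xs<t) with m≤n⇒m<n∨m≡n x<t
... | inj₁ x+1<t rewrite psbStep-bypass xs st out x+1<t =
  last-psbStep-below-top xs st (out ∷ʳ x) xs! xs<t
... | inj₂ refl rewrite psbStep-push x xs st out =
  last-psbStep-below-top xs (suc x ∷ st) out xs! (All.zipWith below (x∉xs , xs<t))
  where
  below : ∀ {y} → x ≢ y × y < suc x → y < x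
  below (x≢y , s≤s y≤x) = ≤∧≢⇒< y≤x (λ y≡x → x≢y (sym y≡x))

last-psbStep-through-max : ∀ as {n bs} st out → All (_≤ n) as → All (_≤ n) st →
  Unique bs → All (_< n) bs → last (psbStep (as ++ n ∷ bs) st out) ≡ just n
last-psbStep-through-max [] {n} {bs} [] out _ _ bs! bs<n =
  last-psbStep-below-top bs [] out bs! bs<n
last-psbStep-through-max [] {n} {bs} (t ∷ st) out _ (t≤n ∷ _) bs! bs<n
  rewrite psbStep-pop bs st out t≤n = last-psbStep-below-top bs [] (out ++ t ∷ st) bs! bs<n
last-psbStep-through-max (a ∷ as) {n} {bs} st out (a≤n ∷ as≤n) st≤n bs! bs<n
  with st′ , out′ , st′≤n , eq ← psbStep-preserves-All-stack (_≤ n) {xs = as ++ n ∷ bs} out a≤n st≤n =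
  trans (cong last eq) (last-psbStep-through-max as st′ out′ as≤n st′≤n bs! bs<n)

-- The run of entries below the current left-to-right maximum t is collected in the second
-- argument and released right after the next left-to-right maximum.
defer : ℕ → List ℕ → List ℕ → List ℕ
defer t block []       = block
defer t block (x ∷ xs) with x <? t
... | yes _ = defer t (block ∷ʳ x) xs
... | no  _ = x ∷ block ++ defer x [] xs

defer-↭ : ∀ t block xs → defer t block xs ↭ block ++ xs
defer-↭ t block [] = ↭-sym (↭-reflexive (++-identityʳ block))
defer-↭ t block (x ∷ xs) with x <? t
... | yes _ = ↭-trans (defer-↭ t (block ∷ʳ x) xs) (↭-reflexive (++-assoc block [ x ] xs))
... | no  _ = ↭-trans (prep x (++⁺ˡ block (defer-↭ x [] xs))) (↭-sym (shift x block xs))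

private
  ∷ʳ-++-assoc : ∀ (out : List ℕ) t block rest → ((out ∷ʳ t) ++ block) ++ rest ≡ out ++ t ∷ block ++ rest
  ∷ʳ-++-assoc out t block rest = trans (++-assoc (out ∷ʳ t) block rest) (++-assoc out [ t ] (block ++ rest))

  bypassable : ∀ {t x} block → All (_< t) block → t < x → All (λ b → suc b < x) block
  bypassable block block<t t<x = All.map (λ b<t → ≤-<-trans b<t t<x) block<t

psbStep-defer : ∀ mid {t M} block out → t < M → All (_< M) mid → Unique (t ∷ mid) →
  All (_< t) block → psbStep (defer t block (mid ∷ʳ M)) [ t ] out ≡ out ++ t ∷ block ++ mid ∷ʳ M
psbStep-defer [] {t} {M} block out t<M _ _ block<t with M <? t
... | yes M<t = ⊥-elim (<-asym t<M M<t)
... | no  _   = begin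
  psbStep (M ∷ block ++ []) [ t ] out
    ≡⟨ psbStep-pop (block ++ []) [] out (<⇒≤ t<M) ⟩
  psbStep (block ++ []) [ M ] (out ∷ʳ t)
    ≡⟨ psbStep-bypass-all block [] [] (out ∷ʳ t) (bypassable block block<t t<M) ⟩
  ((out ∷ʳ t) ++ block) ++ [ M ]
    ≡⟨ ∷ʳ-++-assoc out t block [ M ] ⟩
  out ++ t ∷ block ++ [ M ] ∎
  where open ≡-Reasoning
psbStep-defer (x ∷ xs) {t} {M} block out t<M (x<M ∷ xs<M) ((t≢x ∷ t∉xs) ∷ (x∉xs ∷ xs!)) block<t
  with x <? t
... | yes x<t = begin
  psbStep (defer t (block ∷ʳ x) (xs ∷ʳ M)) [ t ] out
    ≡⟨ psbStep-defer xs (block ∷ʳ x) out t<M xs<M (t∉xs ∷ xs!) (∷ʳ⁺ block<t x<t) ⟩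
  out ++ t ∷ (block ∷ʳ x) ++ xs ∷ʳ M
    ≡⟨ cong (λ rest → out ++ t ∷ rest) (++-assoc block [ x ] (xs ∷ʳ M)) ⟩
  out ++ t ∷ block ++ x ∷ xs ∷ʳ M ∎
  where open ≡-Reasoning
... | no x≮t = begin
  psbStep (x ∷ block ++ defer x [] (xs ∷ʳ M)) [ t ] out
    ≡⟨ psbStep-pop (block ++ defer x [] (xs ∷ʳ M)) [] out (<⇒≤ t<x) ⟩
  psbStep (block ++ defer x [] (xs ∷ʳ M)) [ x ] (out ∷ʳ t)
    ≡⟨ psbStep-bypass-all block (defer x [] (xs ∷ʳ M)) [] (out ∷ʳ t) (bypassable block block<t t<x) ⟩
  psbStep (defer x [] (xs ∷ʳ M)) [ x ] ((out ∷ʳ t) ++ block)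
    ≡⟨ psbStep-defer xs [] ((out ∷ʳ t) ++ block) x<M xs<M (x∉xs ∷ xs!) [] ⟩
  ((out ∷ʳ t) ++ block) ++ x ∷ xs ∷ʳ M
    ≡⟨ ∷ʳ-++-assoc out t block (x ∷ xs ∷ʳ M) ⟩
  out ++ t ∷ block ++ x ∷ xs ∷ʳ M ∎
  where
  open ≡-Reasoning
  t<x : t < x
  t<x = ≤∧≢⇒< (≮⇒≥ x≮t) t≢x

below-max : ∀ {n xs} → All (_≤ n) xs → n ∉ xs → All (_< n) xs
below-max {n} xs≤n n∉xs = All.tabulate λ y∈ → ≤∧≢⇒< (All.lookup xs≤n y∈) λ { refl → n∉xs y∈ }

psb-last : ∀ {n π} → Unique π → n ∈ π → All (_≤ n) π → last (psb π) ≡ just n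
psb-last {n} {π} π! n∈π π≤n with as , bs , refl ← ∈-∃++ n∈π
  with n∉bs ∷ bs! ← Unique-++⁻ʳ as π! =
  last-psbStep-through-max as [] [] (++⁻ˡ as π≤n) [] bs! bs<n
  where
  bs<n : All (_< n) bs
  bs<n = below-max (++⁻ʳ (as ∷ʳ n) (subst (All (_≤ n)) (sym (++-assoc as [ n ] bs)) π≤n))
                   (All¬⇒¬Any n∉bs)

psb-preimage : ∀ {n σ} → Unique σ → All (_≤ n) σ → last σ ≡ just n → ∃[ π ] π ↭ σ × psb π ≡ σ
psb-preimage {n} {σ} σ! σ≤n σ-last with initLast σ
... | [] with () ← σ-last
... | τ ∷ʳ′ y with refl ← just-injective (trans (sym (last-∷ʳ τ y)) σ-last)
  with n∉τ ∷ τ! ← Unique-resp-↭ (↭-sym (∷↭∷ʳ n τ)) σ!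
  with τ
... | [] = [ n ] , ↭-refl , refl
... | t ∷ mid with t<n ∷ mid<n ← below-max (++⁻ˡ (t ∷ mid) σ≤n) (All¬⇒¬Any n∉τ) =
  t ∷ defer t [] (mid ∷ʳ n) ,
  prep t (defer-↭ t [] (mid ∷ʳ n)) ,
  psbStep-defer mid [] [] t<n mid<n τ! []

upTo-≤ : ∀ n → All (_≤ n) (applyUpTo suc n)
upTo-≤ n = applyUpTo⁺₁ suc n (λ i<n → i<n)

upTo-unique : ∀ n → Unique (applyUpTo suc n)
upTo-unique n = Unique.applyUpTo⁺₁ suc n (λ i<j _ → <⇒≢ i<j ∘′ suc-injective)

max∉upTo : ∀ m → suc m ∉ applyUpTo suc m
max∉upTo m m+1∈ = <-irrefl refl (All.lookup (upTo-≤ m) m+1∈)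

upTo-suc-↭ : ∀ m → applyUpTo suc (suc m) ↭ suc m ∷ applyUpTo suc m
upTo-suc-↭ m =
  ↭-trans (↭-reflexive (sym (applyUpTo-∷ʳ suc m))) (↭-sym (∷↭∷ʳ (suc m) (applyUpTo suc m)))

module _ {n π} (π-perm : IsPerm n π) where

  IsPerm⇒≤ : All (_≤ n) π
  IsPerm⇒≤ = All-resp-↭ (↭-sym π-perm) (upTo-≤ n)

  IsPerm⇒unique : Unique π
  IsPerm⇒unique = Unique-resp-↭ (↭-sym π-perm) (upTo-unique n)

IsPerm⇒∋max : ∀ {m π} → IsPerm (suc m) π → suc m ∈ π
IsPerm⇒∋max π-perm = ∈-resp-↭ (↭-sym π-perm) (∈-applyUpTo⁺ suc ≤-refl)

HasPsbPreimage : ℕ → List ℕ → Set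
HasPsbPreimage n σ = Σ (List ℕ) (λ π → IsPerm n π × psb π ≡ σ)

noPsbPreimage⇔ : ∀ m {σ} → IsPerm (suc m) σ → (¬ HasPsbPreimage (suc m) σ) ⇔ (last σ ≢ just (suc m))
noPsbPreimage⇔ m {σ} σ-perm = mk⇔ to from
  where
  to : ¬ HasPsbPreimage (suc m) σ → last σ ≢ just (suc m)
  to no-preimage σ-last
    with π , π↭σ , psbπ≡σ ← psb-preimage (IsPerm⇒unique σ-perm) (IsPerm⇒≤ σ-perm) σ-last =
    no-preimage (π , ↭-trans π↭σ σ-perm , psbπ≡σ)
  from : last σ ≢ just (suc m) → ¬ HasPsbPreimage (suc m) σ
  from σ≢ (π , π-perm , refl) =
    σ≢ (psb-last (IsPerm⇒unique π-perm) (IsPerm⇒∋max π-perm) (IsPerm⇒≤ π-perm))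

withoutPsbPreimage : ℕ → List (List ℕ)
withoutPsbPreimage m = permutationsNotEndingIn (suc m) (applyUpTo suc m)

∈-withoutPsbPreimage⇔ : ∀ m σ →
  σ ∈ withoutPsbPreimage m ⇔ (IsPerm (suc m) σ × ¬ HasPsbPreimage (suc m) σ)
∈-withoutPsbPreimage⇔ m σ = mk⇔
  (λ σ∈ → let σ↭ , σ≢ = ∈-permutationsNotEndingIn⁻ (max∉upTo m) σ∈
              σ-perm = ↭-trans σ↭ (↭-sym (upTo-suc-↭ m))
          in σ-perm , Equivalence.from (noPsbPreimage⇔ m σ-perm) σ≢)
  (λ (σ-perm , no-preimage) → ∈-permutationsNotEndingIn⁺ (↭-trans σ-perm (upTo-suc-↭ m))
     (Equivalence.to (noPsbPreimage⇔ m σ-perm) no-preimage))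

withoutPsbPreimage-unique : ∀ m → Unique (withoutPsbPreimage m)
withoutPsbPreimage-unique m =
  permutationsNotEndingIn-unique (¬Any⇒All¬ (applyUpTo suc m) (max∉upTo m) ∷ upTo-unique m)

length-withoutPsbPreimage : ∀ m → length (withoutPsbPreimage m) ≡ m * m !
length-withoutPsbPreimage m = begin
  length (permutationsNotEndingIn (suc m) (applyUpTo suc m))
    ≡⟨ length-permutationsNotEndingIn (suc m) (applyUpTo suc m) ⟩
  length (applyUpTo suc m) * length (applyUpTo suc m) !
    ≡⟨ cong (λ k → k * k !) (length-applyUpTo suc m) ⟩
  m * m ! ∎
  where open ≡-Reasoning

mainTheorem4 : (m : ℕ) → let n = suc m in
    ((σ : List ℕ) → IsPerm n σ →
      ((¬ Σ (List ℕ) (λ π → IsPerm n π × psb π ≡ σ)) ⇔ (last σ ≢ just n)))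
    × Σ (List (List ℕ)) (λ L → Unique L
        × ((σ : List ℕ) → (σ ∈ L) ⇔ (IsPerm n σ × (¬ Σ (List ℕ) (λ π → IsPerm n π × psb π ≡ σ))))
        × length L ≡ m * m !)
mainTheorem4 m =
  (λ _ → noPsbPreimage⇔ m) ,
  withoutPsbPreimage m ,
  withoutPsbPreimage-unique m ,
  ∈-withoutPsbPreimage⇔ m ,
  length-withoutPsbPreimage m
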